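{- Let $G=(V,E)$ be a finite undirected graph and let $H^{\ast}\subseteq V$ be a nonempty set maximizing $\mathrm{d}(H)=|E(H)|/|H|$ over nonempty $H\subseteq V$. Let $\epsilon\ge 0$ and let $S\subseteq V$ satisfy $|S\cap H^{\ast}|\ge (1-\epsilon)|H^{\ast}|$ and $|S\setminus H^{\ast}|\le \epsilon|H^{\ast}|$. Let $H_1^{\ast}=H^{\ast}\setminus S$. Then $|E(H_1^{\ast})|\le \epsilon\,|E(H^{\ast})|$.
   Context: For $U\subseteq V$, $E(U)$ denotes the set of edges of $G$ with both endpoints in $U$.
   Formalization: The parameter ε ranges over the nonnegative rationals. -}

module Defs where

open import Data.Bool using (Bool; true; false; if_then_else_; _∧_)
open import Data.Nat using (ℕ; _*_; _≤_; _<ᵇ_)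
open import Data.Fin using (Fin; toℕ)
open import Data.Fin.Subset using (Subset; Nonempty; ∣_∣)
open import Data.List using (map; allFin)
open import Data.Nat.ListAction using (sum)
open import Data.Vec using (lookup)
open import Data.Product using (_×_)
open import Data.Integer using (+_)
open import Data.Rational using (ℚ; _/_)
open import Relation.Binary.PropositionalEquality using (_≡_)

record Graph (n : ℕ) : Set where
  field
    adj      : Fin n → Fin n → Bool
    adj-sym  : ∀ i j → adj i j ≡ adj j i
    loopless : ∀ i → adj i i ≡ false
open Graph public

-- |E(U)|: number of edges {i,j} (counted once, via toℕ i < toℕ j)
-- with both endpoints in U.
edgesIn : ∀ {n} → Graph n → Subset n → ℕ
edgesIn {n} G U =
  sum (map (λ i → sum (map (λ j →
         if (toℕ i <ᵇ toℕ j) ∧ lookup U i ∧ lookup U j ∧ adj G i j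
         then 1 else 0) (allFin n))) (allFin n))

-- H maximises d(H) = |E(H)|/|H| over nonempty H ⊆ V.
-- d(H') ≤ d(H) is written by cross-multiplication (both sizes positive).
IsDensest : ∀ {n} → Graph n → Subset n → Set
IsDensest G H =
  Nonempty H ×
  (∀ H' → Nonempty H' → edgesIn G H' * ∣ H ∣ ≤ edgesIn G H * ∣ H' ∣)

ℕ→ℚ : ℕ → ℚ
ℕ→ℚ k = + k / 1

{-# OPTIONS --safe #-}
-- With h = |H*|, b = |H* ─ S| and c = |S ∩ H*| we have h = b + c, so (1 - ε) h ≤ c says b ≤ ε h.
-- Comparing the density of H* with that of H* ─ S (trivially if it is empty) gives
-- |E(H* ─ S)| · h ≤ |E(H*)| · b ≤ ε |E(H*)| · h, and h > 0 can be cancelled.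
module Submission where

open import Defs
open import Data.Nat as ℕ using (ℕ; suc)
import Data.Nat.Properties as ℕ
import Data.Nat.Coprimality as Coprime
open import Data.Integer as ℤ using (+_)
import Data.Integer.Properties as ℤ
open import Data.Rational
  using (ℚ; mkℚ; 0ℚ; 1ℚ; _≤_; _*_; _-_; _+_; *≤*; Positive; NonNegative)
open import Data.Rational.Properties
open import Data.Rational.Solver using (module +-*-Solver)
open import Data.Fin using (toℕ)
open import Data.Fin.Subset using (Subset; ∣_∣; _∩_; _─_; Nonempty; ⊥; inside; outside)
open import Data.Fin.Subset.Properties using (nonempty?; Empty-unique; p⊂q⇒∣p∣<∣q∣; x∈p⇒p-x⊂p)
open import Data.Bool using (_∧_; if_then_else_)
open import Data.Bool.Properties using (∧-zeroʳ)
open import Data.List as List using (List; map; allFin)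
open import Data.Nat.ListAction using (sum)
open import Data.Vec using ([]; _∷_; lookup)
open import Data.Vec.Properties using (lookup-replicate)
open import Data.Product using (_,_)
open import Relation.Nullary using (yes; no)
open import Relation.Binary.PropositionalEquality

ℕ→ℚ≡mkℚ : ∀ k → ℕ→ℚ k ≡ mkℚ (+ k) 0 (Coprime.sym (Coprime.1-coprimeTo k))
ℕ→ℚ≡mkℚ k = normalize-coprime (Coprime.sym (Coprime.1-coprimeTo k))

ℕ→ℚ-+ : ∀ m n → ℕ→ℚ (m ℕ.+ n) ≡ ℕ→ℚ m + ℕ→ℚ n
ℕ→ℚ-+ m n rewrite ℕ→ℚ≡mkℚ m | ℕ→ℚ≡mkℚ n = /-cong (begin
  + (m ℕ.+ n)                 ≡⟨ ℤ.pos-+ m n ⟩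
  + m ℤ.+ + n                 ≡⟨ cong₂ ℤ._+_ (ℤ.*-identityʳ (+ m)) (ℤ.*-identityʳ (+ n)) ⟨
  + m ℤ.* + 1 ℤ.+ + n ℤ.* + 1 ∎) refl
  where open ≡-Reasoning

ℕ→ℚ-* : ∀ m n → ℕ→ℚ (m ℕ.* n) ≡ ℕ→ℚ m * ℕ→ℚ n
ℕ→ℚ-* m n rewrite ℕ→ℚ≡mkℚ m | ℕ→ℚ≡mkℚ n = /-cong (ℤ.pos-* m n) refl

ℕ→ℚ-mono-≤ : ∀ {m n} → m ℕ.≤ n → ℕ→ℚ m ≤ ℕ→ℚ n
ℕ→ℚ-mono-≤ {m} {n} m≤n rewrite ℕ→ℚ≡mkℚ m | ℕ→ℚ≡mkℚ n =
  *≤* (ℤ.*-monoʳ-≤-nonNeg (+ 1) (ℤ.+≤+ m≤n))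

ℕ→ℚ-nonNeg : ∀ k → NonNegative (ℕ→ℚ k)
ℕ→ℚ-nonNeg k = normalize-nonNeg k 1

ℕ→ℚ-pos : ∀ {k} → 0 ℕ.< k → Positive (ℕ→ℚ k)
ℕ→ℚ-pos {suc k} _ = normalize-pos (suc k) 1

∣p─q∣+∣q∩p∣≡∣p∣ : ∀ {n} (p q : Subset n) → ∣ p ─ q ∣ ℕ.+ ∣ q ∩ p ∣ ≡ ∣ p ∣
∣p─q∣+∣q∩p∣≡∣p∣ []            []            = refl
∣p─q∣+∣q∩p∣≡∣p∣ (inside  ∷ p) (inside  ∷ q) = trans (ℕ.+-suc _ _) (cong suc (∣p─q∣+∣q∩p∣≡∣p∣ p q))
∣p─q∣+∣q∩p∣≡∣p∣ (inside  ∷ p) (outside ∷ q) = cong suc (∣p─q∣+∣q∩p∣≡∣p∣ p q)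
∣p─q∣+∣q∩p∣≡∣p∣ (outside ∷ p) (inside  ∷ q) = ∣p─q∣+∣q∩p∣≡∣p∣ p q
∣p─q∣+∣q∩p∣≡∣p∣ (outside ∷ p) (outside ∷ q) = ∣p─q∣+∣q∩p∣≡∣p∣ p q

nonempty⇒∣p∣>0 : ∀ {n} {p : Subset n} → Nonempty p → 0 ℕ.< ∣ p ∣
nonempty⇒∣p∣>0 (_ , x∈p) = ℕ.≤-<-trans ℕ.z≤n (p⊂q⇒∣p∣<∣q∣ (x∈p⇒p-x⊂p x∈p))

sum-map-zero : ∀ {A : Set} (f : A → ℕ) (xs : List A) → (∀ x → f x ≡ 0) → sum (map f xs) ≡ 0
sum-map-zero f List.[]       f≡0 = refl
sum-map-zero f (x List.∷ xs) f≡0 rewrite f≡0 x = sum-map-zero f xs f≡0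

edgesIn-⊥ : ∀ {n} (G : Graph n) → edgesIn G ⊥ ≡ 0
edgesIn-⊥ {n} G =
  sum-map-zero _ (allFin n) λ i → sum-map-zero _ (allFin n) λ j → no-edge i j
  where
  no-edge : ∀ i j →
    (if (toℕ i ℕ.<ᵇ toℕ j) ∧ lookup ⊥ i ∧ lookup ⊥ j ∧ adj G i j then 1 else 0) ≡ 0
  no-edge i j rewrite lookup-replicate i outside | ∧-zeroʳ (toℕ i ℕ.<ᵇ toℕ j) = refl

densest-cross-≤ : ∀ {n} {G : Graph n} {H : Subset n} → IsDensest G H →
                  ∀ U → edgesIn G U ℕ.* ∣ H ∣ ℕ.≤ edgesIn G H ℕ.* ∣ U ∣
densest-cross-≤ {G = G} (_ , densest) U with nonempty? U
... | yes U-nonempty = densest U U-nonempty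
... | no  U-empty rewrite Empty-unique U-empty | edgesIn-⊥ G = ℕ.z≤n

large-share⇒small-rest : ∀ {ε b c h} → h ≡ b + c → (1ℚ - ε) * h ≤ c → b ≤ ε * h
large-share⇒small-rest {ε} {b} {c} refl large-share = begin
  b                                      ≡⟨ solve 3 (λ ε b c → b := (con 1ℚ :- ε) :* (b :+ c) :+ (ε :* (b :+ c) :- c)) refl ε b c ⟩
  (1ℚ - ε) * (b + c) + (ε * (b + c) - c) ≤⟨ +-monoˡ-≤ (ε * (b + c) - c) large-share ⟩
  c + (ε * (b + c) - c)                  ≡⟨ solve 3 (λ ε b c → c :+ (ε :* (b :+ c) :- c) := ε :* (b :+ c)) refl ε b c ⟩
  ε * (b + c)                            ∎
  where
  open ≤-Reasoning
  open +-*-Solver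

ratio-bound : ∀ {ε a e b h} .{{_ : Positive h}} .{{_ : NonNegative e}} →
              a * h ≤ e * b → b ≤ ε * h → a ≤ ε * e
ratio-bound {ε} {a} {e} {b} {h} ah≤eb b≤εh = *-cancelʳ-≤-pos h (begin
  a * h       ≤⟨ ah≤eb ⟩
  e * b       ≤⟨ *-monoˡ-≤-nonNeg e b≤εh ⟩
  e * (ε * h) ≡⟨ solve 3 (λ ε e h → e :* (ε :* h) := ε :* e :* h) refl ε e h ⟩
  ε * e * h   ∎)
  where
  open ≤-Reasoning
  open +-*-Solver

proposition1 : ∀ {n} (G : Graph n) (H* : Subset n) → IsDensest G H* →
    (ε : ℚ) → 0ℚ ≤ ε → (S : Subset n) →
    (1ℚ - ε) * ℕ→ℚ ∣ H* ∣ ≤ ℕ→ℚ ∣ S ∩ H* ∣ →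
    ℕ→ℚ ∣ S ─ H* ∣ ≤ ε * ℕ→ℚ ∣ H* ∣ →
    ℕ→ℚ (edgesIn G (H* ─ S)) ≤ ε * ℕ→ℚ (edgesIn G H*)
-- The hypotheses 0 ≤ ε and |S ─ H*| ≤ ε |H*| are deliberately unused: the first is implied by the
-- overlap hypothesis, and vertices of S outside H* do not affect E(H* ─ S).
proposition1 G H* densest@(H*-nonempty , _) ε _ S large-overlap _ =
  ratio-bound {ε} {b = removed} {h}
    {{ℕ→ℚ-pos (nonempty⇒∣p∣>0 H*-nonempty)}} {{ℕ→ℚ-nonNeg (edgesIn G H*)}}
    density removed≤εh
  where
  h removed kept : ℚ
  h       = ℕ→ℚ ∣ H* ∣
  removed = ℕ→ℚ ∣ H* ─ S ∣
  kept    = ℕ→ℚ ∣ S ∩ H* ∣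

  removed≤εh : removed ≤ ε * h
  removed≤εh = large-share⇒small-rest {ε} {removed} {kept}
    (trans (cong ℕ→ℚ (sym (∣p─q∣+∣q∩p∣≡∣p∣ H* S))) (ℕ→ℚ-+ ∣ H* ─ S ∣ ∣ S ∩ H* ∣))
    large-overlap

  density : ℕ→ℚ (edgesIn G (H* ─ S)) * h ≤ ℕ→ℚ (edgesIn G H*) * removed
  density = subst₂ _≤_ (ℕ→ℚ-* (edgesIn G (H* ─ S)) ∣ H* ∣) (ℕ→ℚ-* (edgesIn G H*) ∣ H* ─ S ∣)
    (ℕ→ℚ-mono-≤ (densest-cross-≤ {G = G} densest (H* ─ S)))
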